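{- For every $n\ge 7$, the set $Z$ of vertices $v$ of $H(n)$ such that a single cop starting at $v$ can guarantee capturing a single robber within at most $n-4$ rounds is exactly $Z=\{1,2\}$.
   Context: All graphs are reflexive. Game of one cop and one robber on $G$: in round $0$ the cop chooses a starting vertex, then the robber chooses his; in each round $i\ge1$ the cop moves to an adjacent vertex or stays, then the robber moves to an adjacent vertex or stays; the robber is captured when he and the cop occupy the same vertex, and the number of rounds needed is the index of the round in which this happens (the robber plays to maximise it). The graph $H(7)$ has vertex set $\{1,\dots,7\}$ and edges $62,21,14$, $56,52,51,54,36,32,31,34$ and $76,74,73$. For $n\ge 8$, $H(n)$ is obtained from $H(n-1)$ by adding a vertex $n$ adjacent to $n-1$, $n-3$ and $n-4$. -}

module Defs where

open import Data.Nat using (ℕ; zero; suc; _+_; _≤_)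
open import Data.Product using (Σ; _×_)
open import Data.Sum using (_⊎_)
open import Relation.Binary.PropositionalEquality using (_≡_)

-- Directed list of edges of the infinite graph H(∞) = ⋃ H(n).
-- Each edge is listed once; adjacency below symmetrises it.
data Edge : ℕ → ℕ → Set where
  -- edges of H(7)
  e62 : Edge 6 2
  e21 : Edge 2 1
  e14 : Edge 1 4
  e56 : Edge 5 6
  e52 : Edge 5 2
  e51 : Edge 5 1
  e54 : Edge 5 4
  e36 : Edge 3 6
  e32 : Edge 3 2
  e31 : Edge 3 1
  e34 : Edge 3 4
  e76 : Edge 7 6
  e74 : Edge 7 4
  e73 : Edge 7 3
  ext1 : ∀ k → Edge (8 + k) (7 + k)
  ext3 : ∀ k → Edge (8 + k) (5 + k)
  ext4 : ∀ k → Edge (8 + k) (4 + k)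

InV : ℕ → ℕ → Set
InV n v = 1 ≤ v × v ≤ n

-- Closed (reflexive) adjacency in H(n).  Since every new vertex is only
-- joined to smaller vertices, H(n) is the subgraph of H(∞) induced on {1,…,n}.
Adj : ℕ → ℕ → ℕ → Set
Adj n u v = InV n u × InV n v × (u ≡ v ⊎ Edge u v ⊎ Edge v u)

-- CopWins n k c r : in H(n), with the cop at c and the robber at r and the
-- cop to move, the cop can guarantee capture within k further rounds.
-- Capture happens if the positions coincide, or the cop moves onto the
-- robber, or the robber (forced to move to an adjacent vertex or stay)
-- lands on the cop's new position (covered by the c ≡ r clause next level).
CopWins : ℕ → ℕ → ℕ → ℕ → Set
CopWins n zero    c r = c ≡ r
CopWins n (suc k) c r =
  c ≡ r ⊎ Σ ℕ (λ c' → Adj n c c' ×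
            (c' ≡ r ⊎ (∀ r' → Adj n r r' → CopWins n k c' r')))

CanCaptureFrom : ℕ → ℕ → ℕ → Set
CanCaptureFrom n m v = ∀ r → InV n r → CopWins n m v r

{-# OPTIONS --safe #-}
-- Apart from the edge 13, H(n) is the path 1, …, n with steps ±1, ±3, ±4.  A cop who has the robber a
-- positive multiple of 4 ahead keeps it that way: every robber move changes the distance by 0, ±1, ±3
-- or ±4, and the cop answers with the forward step of 4, 1 or 3 (or 2 along 13) congruent to it.  The
-- cop thus advances every round while the robber stays at most n, so from 1 he captures within n − 4
-- rounds.  From 2 the same works unless the robber is at distance ≡ 2 (mod 4); then the cop first
-- retreats to 1, after which the robber can never get to distance ≡ 1 and the longer steps make up for
-- the lost round.  Against a cop starting at v ≥ 3 the robber starts two vertices away and keeps the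
-- distance ≡ 2 (mod 4), which no step of the cop can close; near the ends of the path, and when the cop
-- returns to 1 or 2, he switches to positions where the cop's chase is exactly as slow as the bound.
module Submission where

open import Data.Empty using (⊥-elim)
open import Data.Nat using (ℕ; zero; suc; _+_; _∸_; _≤_; z≤n; s≤s; s≤s⁻¹; z<s; _≤?_)
open import Data.Nat.Properties
  using (≤-refl; ≤-trans; ≤-reflexive; m≤m+n; m≤n+m; m≤n⇒m≤o+n; m+n≤o⇒m≤o; m+n≤o⇒n≤o; +-monoˡ-≤; +-monoʳ-≤;
         +-identityʳ; +-suc; +-comm; m+[n∸m]≡n; m≢1+n+m; 1+n≰n; +-commutativeSemigroup; module ≤-Reasoning)
open import Data.Product using (Σ; _×_; _,_)
open import Data.Sum using (_⊎_; inj₁; inj₂)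
open import Function.Base using (_∘_)
open import Function.Bundles using (_⇔_; mk⇔)
open import Relation.Nullary using (¬_; yes; no)
open import Relation.Binary.PropositionalEquality using (_≡_; _≢_; refl; sym; subst; cong)
open import Algebra.Properties.CommutativeSemigroup +-commutativeSemigroup using (xy∙z≈y∙xz)

open import Defs

data Move : ℕ → ℕ → Set where
  stay   : ∀ u → Move u u
  up1    : ∀ u → Move u (1 + u)
  up3    : ∀ u → Move u (3 + u)
  up4    : ∀ u → Move u (4 + u)
  down1  : ∀ u → Move (1 + u) u
  down3  : ∀ u → Move (3 + u) u
  down4  : ∀ u → Move (4 + u) u
  up13   : Move 1 3
  down31 : Move 3 1

move-sym : ∀ {u v} → Move u v → Move v u
move-sym (stay u)  = stay u
move-sym (up1 u)   = down1 u
move-sym (up3 u)   = down3 u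
move-sym (up4 u)   = down4 u
move-sym (down1 u) = up1 u
move-sym (down3 u) = up3 u
move-sym (down4 u) = up4 u
move-sym up13      = down31
move-sym down31    = up13

edge⇒move : ∀ {u v} → Edge u v → Move u v
edge⇒move e62      = down4 2
edge⇒move e21      = down1 1
edge⇒move e14      = up3 1
edge⇒move e56      = up1 5
edge⇒move e52      = down3 2
edge⇒move e51      = down4 1
edge⇒move e54      = down1 4
edge⇒move e36      = up3 3
edge⇒move e32      = down1 2
edge⇒move e31      = down31
edge⇒move e34      = up1 3
edge⇒move e76      = down1 6
edge⇒move e74      = down3 4
edge⇒move e73      = down4 3
edge⇒move (ext1 k) = down1 (7 + k)
edge⇒move (ext3 k) = down3 (5 + k)
edge⇒move (ext4 k) = down4 (4 + k)

Linked : ℕ → ℕ → Set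
Linked u v = u ≡ v ⊎ Edge u v ⊎ Edge v u

linked-sym : ∀ {u v} → Linked u v → Linked v u
linked-sym (inj₁ refl)     = inj₁ refl
linked-sym (inj₂ (inj₁ e)) = inj₂ (inj₂ e)
linked-sym (inj₂ (inj₂ e)) = inj₂ (inj₁ e)

linked-up1 : ∀ u → 1 ≤ u → Linked u (1 + u)
linked-up1 1 _ = inj₂ (inj₂ e21)
linked-up1 2 _ = inj₂ (inj₂ e32)
linked-up1 3 _ = inj₂ (inj₁ e34)
linked-up1 4 _ = inj₂ (inj₂ e54)
linked-up1 5 _ = inj₂ (inj₁ e56)
linked-up1 6 _ = inj₂ (inj₂ e76)
linked-up1 (suc (suc (suc (suc (suc (suc (suc k))))))) _ = inj₂ (inj₂ (ext1 k))

linked-up3 : ∀ u → 1 ≤ u → Linked u (3 + u)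
linked-up3 1 _ = inj₂ (inj₁ e14)
linked-up3 2 _ = inj₂ (inj₂ e52)
linked-up3 3 _ = inj₂ (inj₁ e36)
linked-up3 4 _ = inj₂ (inj₂ e74)
linked-up3 (suc (suc (suc (suc (suc k))))) _ = inj₂ (inj₂ (ext3 k))

linked-up4 : ∀ u → 1 ≤ u → Linked u (4 + u)
linked-up4 1 _ = inj₂ (inj₂ e51)
linked-up4 2 _ = inj₂ (inj₂ e62)
linked-up4 3 _ = inj₂ (inj₂ e73)
linked-up4 (suc (suc (suc (suc k)))) _ = inj₂ (inj₂ (ext4 k))

move⇒linked : ∀ {u v} → 1 ≤ u → 1 ≤ v → Move u v → Linked u v
move⇒linked _  _  (stay u)  = inj₁ refl
move⇒linked 1≤u _ (up1 u)   = linked-up1 u 1≤u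
move⇒linked 1≤u _ (up3 u)   = linked-up3 u 1≤u
move⇒linked 1≤u _ (up4 u)   = linked-up4 u 1≤u
move⇒linked _ 1≤v (down1 v) = linked-sym (linked-up1 v 1≤v)
move⇒linked _ 1≤v (down3 v) = linked-sym (linked-up3 v 1≤v)
move⇒linked _ 1≤v (down4 v) = linked-sym (linked-up4 v 1≤v)
move⇒linked _  _  up13      = inj₂ (inj₂ e31)
move⇒linked _  _  down31    = inj₂ (inj₁ e31)

adj⇒move : ∀ {n u v} → Adj n u v → Move u v
adj⇒move (_ , _ , inj₁ refl)     = stay _
adj⇒move (_ , _ , inj₂ (inj₁ e)) = edge⇒move e
adj⇒move (_ , _ , inj₂ (inj₂ e)) = move-sym (edge⇒move e)

move⇒adj : ∀ {n u v} → Move u v → InV n u → InV n v → Adj n u v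
move⇒adj m (1≤u , u≤n) (1≤v , v≤n) = (1≤u , u≤n) , (1≤v , v≤n) , move⇒linked 1≤u 1≤v m

data Mult4 : ℕ → Set where
  mult0  : Mult4 0
  mult+4 : ∀ {x} → Mult4 x → Mult4 (4 + x)

data Residue4 : ℕ → Set where
  res0 : Residue4 0
  res1 : ∀ {x} → Mult4 x → Residue4 (1 + x)
  res2 : ∀ {x} → Mult4 x → Residue4 (2 + x)
  res3 : ∀ {x} → Mult4 x → Residue4 (3 + x)
  res4 : ∀ {x} → Mult4 x → Residue4 (4 + x)

residue4 : ∀ d → Residue4 d
residue4 0 = res0
residue4 1 = res1 mult0
residue4 2 = res2 mult0
residue4 3 = res3 mult0
residue4 (suc (suc (suc (suc d)))) with residue4 d
... | res0   = res4 mult0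
... | res1 q = res1 (mult+4 q)
... | res2 q = res2 (mult+4 q)
... | res3 q = res3 (mult+4 q)
... | res4 q = res4 (mult+4 q)

shift : ∀ ε a c → ε + a + c ≡ a + (ε + c)
shift = xy∙z≈y∙xz

data Advance : ℕ → ℕ → Set where
  adv1 : ∀ {c} → Advance c 1
  adv2 : Advance 1 2
  adv3 : ∀ {c} → Advance c 3
  adv4 : ∀ {c} → Advance c 4

advance⇒move : ∀ {c δ} → Advance c δ → Move c (δ + c)
advance⇒move adv1 = up1 _
advance⇒move adv2 = up13
advance⇒move adv3 = up3 _
advance⇒move adv4 = up4 _

1≤stride : ∀ {c δ} → Advance c δ → 1 ≤ δ
1≤stride adv1 = z<s
1≤stride adv2 = z<s
1≤stride adv3 = z<s
1≤stride adv4 = z<s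

data Ahead (c : ℕ) : ℕ → Set where
  caught : Ahead c c
  ahead  : ∀ {δ x} → Advance c δ → Mult4 x → Ahead c (δ + x + c)

ahead-after-reply : ∀ {c x r} → Mult4 x → Move (4 + x + c) r → Ahead c r
ahead-after-reply q          (stay _)  = ahead adv4 q
ahead-after-reply q          (up1 _)   = ahead adv1 (mult+4 q)
ahead-after-reply q          (up3 _)   = ahead adv3 (mult+4 q)
ahead-after-reply q          (up4 _)   = ahead adv4 (mult+4 q)
ahead-after-reply q          (down1 _) = ahead adv3 q
ahead-after-reply q          (down3 _) = ahead adv1 q
ahead-after-reply mult0      (down4 _) = caught
ahead-after-reply (mult+4 q) (down4 _) = ahead adv4 q

module Cop (n : ℕ) where

  advance-adj : ∀ {c δ x} → Advance c δ → 1 ≤ c → δ + x + c ≤ n → Adj n c (δ + c)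
  advance-adj {c} {δ} {x} adv 1≤c r≤n =
    move⇒adj (advance⇒move adv) (1≤c , ≤-trans (m≤n+m c (δ + x)) r≤n)
                                (≤-trans 1≤c (m≤n+m c δ) , ≤-trans (+-monoˡ-≤ c (m≤m+n δ x)) r≤n)

  chase : ∀ j {c δ x} → Advance c δ → Mult4 x → 1 ≤ c → δ + x + c ≤ n → n ≤ 3 + (δ + c) + j →
          CopWins n (suc j) c (δ + x + c)
  pursue : ∀ j {c x r} → Mult4 x → 1 ≤ c → r ≡ 4 + x + c → r ≤ n → n ≤ 3 + c + j →
           ∀ r′ → Adj n r r′ → CopWins n j c r′

  chase j {c} {δ} adv mult0 1≤c r≤n budget =
    inj₂ (δ + c , advance-adj adv 1≤c r≤n , inj₁ (cong (_+ c) (sym (+-identityʳ δ))))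
  chase j {c} {δ} adv (mult+4 q) 1≤c r≤n budget =
    inj₂ (δ + c , advance-adj adv 1≤c r≤n ,
          inj₂ (pursue j q (≤-trans 1≤c (m≤n+m c δ)) (shift δ (4 + _) c) r≤n budget))

  pursue zero {c} {x} _ _ refl r≤n budget _ _ = ⊥-elim (1+n≰n (begin
    4 + c      ≤⟨ +-monoˡ-≤ c (m≤m+n 4 x) ⟩
    4 + x + c  ≤⟨ r≤n ⟩
    n          ≤⟨ budget ⟩
    3 + c + 0  ≡⟨ +-identityʳ (3 + c) ⟩
    3 + c      ∎))
    where open ≤-Reasoning
  pursue (suc j) {c} q 1≤c refl _ budget r′ a@(_ , (_ , r′≤n) , _) with ahead-after-reply q (adj⇒move a)
  ... | caught       = inj₁ refl
  ... | ahead adv q′ = chase j adv q′ 1≤c r′≤n (≤-trans budget (pursuit-budget (1≤stride adv)))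
    where
    pursuit-budget : ∀ {δ} → 1 ≤ δ → 3 + c + suc j ≤ 3 + (δ + c) + j
    pursuit-budget 1≤δ =
      ≤-trans (≤-reflexive (+-suc (3 + c) j)) (+-monoˡ-≤ j (+-monoʳ-≤ 3 (+-monoˡ-≤ c 1≤δ)))

module _ (m : ℕ) where
  open Cop (7 + m)

  chase-from-1 : ∀ d {r} → d + 1 ≡ r → r ≤ 7 + m → CopWins (7 + m) (3 + m) 1 r
  chase-from-1 d refl r≤n with residue4 d
  ... | res0   = inj₁ refl
  ... | res1 q = chase (2 + m) adv1 q z<s r≤n ≤-refl
  ... | res2 q = chase (2 + m) adv2 q z<s r≤n (m≤n+m _ 1)
  ... | res3 q = chase (2 + m) adv3 q z<s r≤n (m≤n+m _ 2)
  ... | res4 q = chase (2 + m) adv4 q z<s r≤n (m≤n+m _ 3)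

  -- From distance ≡ 3 (mod 4) the robber cannot reach distance ≡ 1, so every chase step from 1
  -- has length at least 2; this pays for the round lost by retreating from 2 to 1.
  chase-after-retreat : ∀ {x r} → Mult4 x → Move (3 + x + 1) r → InV (7 + m) r →
                        CopWins (7 + m) (2 + m) 1 r
  chase-after-retreat mult0      (down4 _) (() , _)
  chase-after-retreat (mult+4 q) (down4 _) (_ , r≤n) = chase (1 + m) adv3 q z<s r≤n (m≤n+m _ 1)
  chase-after-retreat mult0      (down3 _) _         = inj₁ refl
  chase-after-retreat (mult+4 q) (down3 _) (_ , r≤n) = chase (1 + m) adv4 q z<s r≤n (m≤n+m _ 2)
  chase-after-retreat q          (stay _)  (_ , r≤n) = chase (1 + m) adv3 q z<s r≤n (m≤n+m _ 1)
  chase-after-retreat q          (up1 _)   (_ , r≤n) = chase (1 + m) adv4 q z<s r≤n (m≤n+m _ 2)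
  chase-after-retreat q          (up3 _)   (_ , r≤n) = chase (1 + m) adv2 (mult+4 q) z<s r≤n ≤-refl
  chase-after-retreat q          (up4 _)   (_ , r≤n) = chase (1 + m) adv3 (mult+4 q) z<s r≤n (m≤n+m _ 1)
  chase-after-retreat q          (down1 _) (_ , r≤n) = chase (1 + m) adv2 q z<s r≤n ≤-refl

  2→1 : Adj (7 + m) 2 1
  2→1 = move⇒adj (down1 1) (z<s , s≤s z<s) (z<s , z<s)

  chase-from-2 : ∀ d {r} → d + 2 ≡ r → r ≤ 7 + m → CopWins (7 + m) (3 + m) 2 r
  chase-from-2 d refl r≤n with residue4 d
  ... | res0   = inj₁ refl
  ... | res1 q = chase (2 + m) adv1 q z<s r≤n (m≤n+m _ 1)
  ... | res3 q = chase (2 + m) adv3 q z<s r≤n (m≤n+m _ 3)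
  ... | res4 q = chase (2 + m) adv4 q z<s r≤n (m≤n+m _ 4)
  ... | res2 {x} q = inj₂ (1 , 2→1 , inj₂ reply)
    where
    reply : ∀ r′ → Adj (7 + m) (2 + x + 2) r′ → CopWins (7 + m) (2 + m) 1 r′
    reply r′ a@(_ , r′∈V , _) =
      chase-after-retreat q (subst (λ p → Move p r′) (sym (shift 1 (2 + x) 1)) (adj⇒move a)) r′∈V

  capture-from-1 : CanCaptureFrom (7 + m) (3 + m) 1
  capture-from-1 (suc d) (_ , r≤n) = chase-from-1 d (+-comm d 1) r≤n

  capture-from-2 : CanCaptureFrom (7 + m) (3 + m) 2
  capture-from-2 1             _         = inj₂ (1 , 2→1 , inj₁ refl)
  capture-from-2 (suc (suc d)) (_ , r≤n) = chase-from-2 d (+-comm d 2) r≤n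

module Robber (n : ℕ) (7≤n : 7 ≤ n) where

  -- The bounds on j are sharp: in a chased position, for instance, Cop.chase captures within j + 1
  -- rounds as soon as n ≤ δ + 3 + j + c.
  data Safe : ℕ → ℕ → ℕ → Set where
    chased          : ∀ {j c δ x r} → Advance c δ → Mult4 x → 1 ≤ c → r ≡ δ + (4 + x) + c → r ≤ n →
                      δ + 3 + j + c ≤ n → Safe j c r
    ahead-by-2      : ∀ {j c x r} → Mult4 x → 3 ≤ c → r ≡ 2 + x + c → r ≤ n → 4 + j ≤ n → Safe j c r
    ahead-by-2-of-2 : ∀ {j x r} → Mult4 x → r ≡ 2 + x + 2 → r ≤ n → 5 + j ≤ n → Safe j 2 r
    behind-by-2     : ∀ {j r} → 2 ≤ r → r ≤ n → 4 + j ≤ n → Safe j (2 + r) r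
    last-round      : ∀ {c r} → c ≢ r → Safe 0 c r

  Escape : ℕ → ℕ → ℕ → Set
  Escape j c r = c ≢ r × Σ ℕ λ r′ → Adj n r r′ × Safe j c r′

  escape : ∀ {j c r r′} → c ≢ r → Move r r′ → InV n r → InV n r′ → Safe j c r′ → Escape j c r
  escape c≢r mv r∈V r′∈V safe = c≢r , _ , move⇒adj mv r∈V r′∈V , safe

  ahead-≢ : ∀ {c} k x → c ≢ suc k + x + c
  ahead-≢ _ _ = m≢1+n+m _

  behind-≢ : ∀ {r} k → suc k + r ≢ r
  behind-≢ _ e = m≢1+n+m _ (sym e)

  shift-≤ : ∀ ε a c → ε + a + c ≤ n → a + (ε + c) ≤ n
  shift-≤ ε a c = subst (_≤ n) (shift ε a c)

  unshift-≤ : ∀ ε a c → a + (ε + c) ≤ n → ε + a + c ≤ n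
  unshift-≤ ε a c = subst (_≤ n) (sym (shift ε a c))

  spare : ∀ k {a c} → k + a + c ≤ n → a ≤ n
  spare k {a} = m+n≤o⇒n≤o k ∘ m+n≤o⇒m≤o (k + a)

  budget-at-1 : ∀ a → 1 + a ≤ n → a + 1 ≤ n
  budget-at-1 a = subst (_≤ n) (+-comm 1 a)

  2≤2+ : ∀ {c} → 2 ≤ 2 + c
  2≤2+ = s≤s z<s

  3≤3+ : ∀ {c} → 3 ≤ 3 + c
  3≤3+ = s≤s 2≤2+

  6≤n : 6 ≤ n
  6≤n = m+n≤o⇒n≤o 1 7≤n

  escape-ahead-4 : ∀ {j c x r} → Mult4 x → 1 ≤ c → r ≡ 4 + x + c → r ≤ n → 4 + j + c ≤ n → Escape j c r
  escape-ahead-4 {x = x} (mult+4 q) 1≤c refl r≤n budget =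
    escape (ahead-≢ 3 x) (down3 _) (z<s , r≤n) (z<s , m+n≤o⇒n≤o 3 r≤n)
           (chased adv1 q 1≤c refl (m+n≤o⇒n≤o 3 r≤n) budget)
  escape-ahead-4 {zero} mult0 _ refl r≤n _ =
    escape (ahead-≢ 3 0) (stay _) (z<s , r≤n) (z<s , r≤n) (last-round (ahead-≢ 3 0))
  escape-ahead-4 {suc j} {c} mult0 1≤c refl r≤n budget =
    escape (ahead-≢ 3 0) (up1 _) (z<s , r≤n) (z<s , 5+c≤n) (chased adv1 mult0 1≤c refl 5+c≤n budget)
    where
    5+c≤n : 5 + c ≤ n
    5+c≤n = ≤-trans (+-monoˡ-≤ c (m≤m+n 5 j)) budget

  escape-ahead-2 : ∀ {j c x r} → Mult4 x → 1 ≤ c → r ≡ 2 + x + c → r ≤ n → 5 + j ≤ n → Escape j c r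
  escape-ahead-2 {c = 1} mult0 _ refl r≤n budget =
    escape (ahead-≢ 1 0) (up3 _) (z<s , r≤n) (z<s , 6≤n)
           (chased adv1 mult0 z<s refl 6≤n (budget-at-1 _ budget))
  escape-ahead-2 {c = 1} {x} (mult+4 q) _ refl r≤n budget =
    escape (ahead-≢ 1 x) (down1 _) (z<s , r≤n) (z<s , m+n≤o⇒n≤o 1 r≤n)
           (chased adv1 q z<s refl (m+n≤o⇒n≤o 1 r≤n) (budget-at-1 _ budget))
  escape-ahead-2 {c = 2} {x} q _ refl r≤n budget =
    escape (ahead-≢ 1 x) (stay _) (z<s , r≤n) (z<s , r≤n) (ahead-by-2-of-2 q refl r≤n budget)
  escape-ahead-2 {c = suc (suc (suc c))} {x} q _ refl r≤n budget =
    escape (ahead-≢ 1 x) (stay _) (z<s , r≤n) (z<s , r≤n)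
           (ahead-by-2 q 3≤3+ refl r≤n (m+n≤o⇒n≤o 1 budget))

  escape-ahead-3 : ∀ {j c x r} → Mult4 x → 2 ≤ c → r ≡ 3 + x + c → r ≤ n → 5 + j ≤ n → Escape j c r
  escape-ahead-3 {c = 1} _ (s≤s ()) _ _ _
  escape-ahead-3 {c = 2} {x} q _ refl r≤n budget =
    escape (ahead-≢ 2 x) (down1 _) (z<s , r≤n) (z<s , m+n≤o⇒n≤o 1 r≤n)
           (ahead-by-2-of-2 q refl (m+n≤o⇒n≤o 1 r≤n) budget)
  escape-ahead-3 {c = suc (suc (suc c))} {x} q _ refl r≤n budget =
    escape (ahead-≢ 2 x) (down1 _) (z<s , r≤n) (z<s , m+n≤o⇒n≤o 1 r≤n)
           (ahead-by-2 q 3≤3+ refl (m+n≤o⇒n≤o 1 r≤n) (m+n≤o⇒n≤o 1 budget))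

  escape-ahead-3′ : ∀ {j c x r} → Mult4 x → 1 ≤ c → r ≡ 3 + x + c → r ≤ n → 6 + j ≤ n → Escape j c r
  escape-ahead-3′ {c = 1} mult0 _ refl r≤n budget =
    escape (ahead-≢ 2 0) (up3 _) (z<s , r≤n) (z<s , 7≤n)
           (chased adv2 mult0 z<s refl 7≤n (budget-at-1 _ budget))
  escape-ahead-3′ {c = 1} {x} (mult+4 q) _ refl r≤n budget =
    escape (ahead-≢ 2 x) (down1 _) (z<s , r≤n) (z<s , m+n≤o⇒n≤o 1 r≤n)
           (chased adv2 q z<s refl (m+n≤o⇒n≤o 1 r≤n) (budget-at-1 _ budget))
  escape-ahead-3′ {c = suc (suc c)} q _ refl r≤n budget =
    escape-ahead-3 q (s≤s z<s) refl r≤n (m+n≤o⇒n≤o 1 budget)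

  escape-to-behind-2 : ∀ {j r r′} → Move r r′ → 2 + r′ ≢ r → 2 ≤ r → r ≤ n → 2 ≤ r′ → 2 + r′ ≤ n →
                       5 + j ≤ n → Escape j (2 + r′) r
  escape-to-behind-2 mv c≢r 2≤r r≤n 2≤r′ c≤n budget =
    escape c≢r mv (≤-trans z<s 2≤r , r≤n) (≤-trans z<s 2≤r′ , m+n≤o⇒n≤o 2 c≤n)
           (behind-by-2 2≤r′ (m+n≤o⇒n≤o 2 c≤n) (m+n≤o⇒n≤o 1 budget))

  escape-behind-1 : ∀ {j r} → 2 ≤ r → 1 + r ≤ n → 5 + j ≤ n → Escape j (1 + r) r
  escape-behind-1 {r = 1} (s≤s ()) _ _
  escape-behind-1 {r = 2} _ c≤n budget =
    escape (behind-≢ 0) (up3 _) (z<s , m+n≤o⇒n≤o 1 c≤n) (z<s , m+n≤o⇒n≤o 2 7≤n)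
           (ahead-by-2 mult0 3≤3+ refl (m+n≤o⇒n≤o 2 7≤n) (m+n≤o⇒n≤o 1 budget))
  escape-behind-1 {r = suc (suc (suc r))} _ c≤n budget =
    escape-to-behind-2 (down1 _) (behind-≢ 0) 2≤2+ (m+n≤o⇒n≤o 1 c≤n) 2≤2+ c≤n budget

  escape-ahead-1 : ∀ {j c x r} → Mult4 x → 1 ≤ c → r ≡ 1 + x + c → r ≤ n → 5 + j ≤ n → Escape j c r
  escape-ahead-1 {c = 1} mult0 _ refl r≤n budget =
    escape (ahead-≢ 0 0) (up4 _) (z<s , r≤n) (z<s , 6≤n)
           (chased adv1 mult0 z<s refl 6≤n (budget-at-1 _ budget))
  escape-ahead-1 {c = 1} {x} (mult+4 q) _ refl r≤n budget =
    escape (ahead-≢ 0 x) (stay _) (z<s , r≤n) (z<s , r≤n) (chased adv1 q z<s refl r≤n (budget-at-1 _ budget))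
  escape-ahead-1 {c = 2} mult0 _ refl r≤n budget =
    escape (ahead-≢ 0 0) (up1 _) (z<s , r≤n) (z<s , m+n≤o⇒n≤o 3 7≤n)
           (ahead-by-2-of-2 mult0 refl (m+n≤o⇒n≤o 3 7≤n) budget)
  escape-ahead-1 {c = 2} {x} (mult+4 q) _ refl r≤n budget =
    escape (ahead-≢ 0 x) (down3 _) (z<s , r≤n) (z<s , m+n≤o⇒n≤o 3 r≤n)
           (ahead-by-2-of-2 q refl (m+n≤o⇒n≤o 3 r≤n) budget)
  escape-ahead-1 {c = suc (suc (suc c))} {x} (mult+4 q) _ refl r≤n budget =
    escape (ahead-≢ 0 x) (down3 _) (z<s , r≤n) (z<s , m+n≤o⇒n≤o 3 r≤n)
           (ahead-by-2 q 3≤3+ refl (m+n≤o⇒n≤o 3 r≤n) (m+n≤o⇒n≤o 1 budget))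
  escape-ahead-1 {c = suc (suc (suc c))} mult0 _ refl r≤n budget with 5 + c ≤? n
  ... | yes 5+c≤n =
    escape (ahead-≢ 0 0) (up1 _) (z<s , r≤n) (z<s , 5+c≤n)
           (ahead-by-2 mult0 3≤3+ refl 5+c≤n (m+n≤o⇒n≤o 1 budget))
  escape-ahead-1 {c = 3} mult0 _ refl r≤n budget | no 5≰n = ⊥-elim (5≰n (m+n≤o⇒n≤o 2 7≤n))
  escape-ahead-1 {c = suc (suc (suc (suc c)))} mult0 _ refl r≤n budget | no _ =
    escape-to-behind-2 (down3 _) (ahead-≢ 0 0) 2≤2+ r≤n 2≤2+ (m+n≤o⇒n≤o 1 r≤n) budget

  evade-chased-1 : ∀ {j c c′ x} → Mult4 x → 1 ≤ c → 1 + (4 + x) + c ≤ n → 1 + 3 + suc j + c ≤ n →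
                   Move c c′ → InV n c′ → Escape j c′ (1 + (4 + x) + c)
  evade-chased-1 {j} {c} {x = x} q 1≤c r≤n budget mv c′∈V with mv | c′∈V
  ... | stay _   | _ = escape-ahead-1 (mult+4 q) 1≤c refl r≤n (spare 0 budget)
  ... | up1 _    | _ = escape-ahead-4 q z<s (shift 1 (4 + x) c) r≤n (shift-≤ 1 (4 + j) c budget)
  ... | up3 _    | _ = escape-ahead-2 q z<s (shift 3 (2 + x) c) r≤n (spare 0 budget)
  ... | up4 _    | _ = escape-ahead-1 q z<s (shift 4 (1 + x) c) r≤n (spare 0 budget)
  ... | down1 c′ | (1≤c′ , _) =
    escape-ahead-2 (mult+4 q) 1≤c′ (sym (shift 1 (5 + x) c′)) r≤n (spare 0 budget)
  ... | down3 c′ | (1≤c′ , _) =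
    escape-ahead-4 (mult+4 q) 1≤c′ (sym (shift 3 (5 + x) c′)) r≤n
                   (m+n≤o⇒n≤o 4 (unshift-≤ 3 (5 + j) c′ budget))
  ... | down4 c′ | (1≤c′ , _) =
    escape-ahead-1 (mult+4 (mult+4 q)) 1≤c′ (sym (shift 4 (5 + x) c′)) r≤n (spare 0 budget)
  ... | up13     | _ = escape-ahead-3 q (s≤s z<s) (shift 2 (3 + x) 1) r≤n (spare 0 budget)
  ... | down31   | _ =
    escape-ahead-3′ (mult+4 q) z<s (sym (shift 2 (5 + x) 1)) r≤n
                    (m+n≤o⇒n≤o 1 (m+n≤o⇒m≤o _ (unshift-≤ 2 (5 + j) 1 budget)))

  evade-chased-2 : ∀ {j c′ x} → Mult4 x → 2 + (4 + x) + 1 ≤ n → 2 + 3 + suc j + 1 ≤ n →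
                   Move 1 c′ → InV n c′ → Escape j c′ (2 + (4 + x) + 1)
  evade-chased-2 {j} {x = x} q r≤n budget mv c′∈V with mv | c′∈V
  ... | stay _  | _ = escape-ahead-2 (mult+4 q) z<s refl r≤n (spare 1 budget)
  ... | up1 _   | _ = escape-ahead-1 (mult+4 q) z<s (shift 1 (5 + x) 1) r≤n (spare 1 budget)
  ... | up3 _   | _ = escape-ahead-3 q (s≤s z<s) (shift 3 (3 + x) 1) r≤n (spare 1 budget)
  ... | up4 _   | _ = escape-ahead-2 q z<s (shift 4 (2 + x) 1) r≤n (spare 1 budget)
  ... | up13    | _ = escape-ahead-4 q z<s (shift 2 (4 + x) 1) r≤n (shift-≤ 2 (4 + j) 1 budget)
  ... | down1 _ | (() , _)

  evade-chased-3 : ∀ {j c c′ x} → Mult4 x → 1 ≤ c → 3 + (4 + x) + c ≤ n → 3 + 3 + suc j + c ≤ n →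
                   Move c c′ → InV n c′ → Escape j c′ (3 + (4 + x) + c)
  evade-chased-3 {j} {c} {x = x} q 1≤c r≤n budget mv c′∈V with mv | c′∈V
  ... | stay _   | _ = escape-ahead-3′ (mult+4 q) 1≤c refl r≤n (spare 1 budget)
  ... | up1 _    | _ = escape-ahead-2 (mult+4 q) z<s (shift 1 (6 + x) c) r≤n (spare 2 budget)
  ... | up3 _    | _ = escape-ahead-4 q z<s (shift 3 (4 + x) c) r≤n (shift-≤ 3 (4 + j) c budget)
  ... | up4 _    | _ = escape-ahead-3 q (s≤s z<s) (shift 4 (3 + x) c) r≤n (spare 2 budget)
  ... | down1 c′ | (1≤c′ , _) =
    escape-ahead-4 (mult+4 q) 1≤c′ (sym (shift 1 (7 + x) c′)) r≤n
                   (m+n≤o⇒n≤o 4 (unshift-≤ 1 (7 + j) c′ budget))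
  ... | down3 c′ | (1≤c′ , _) =
    escape-ahead-2 (mult+4 (mult+4 q)) 1≤c′ (sym (shift 3 (7 + x) c′)) r≤n (spare 2 budget)
  ... | down4 c′ | (1≤c′ , _) =
    escape-ahead-3′ (mult+4 (mult+4 q)) 1≤c′ (sym (shift 4 (7 + x) c′)) r≤n (spare 1 budget)
  ... | up13     | _ =
    escape-ahead-1 (mult+4 q) z<s (shift 2 (5 + x) 1) r≤n (spare 2 budget)
  ... | down31   | _ =
    escape-ahead-1 (mult+4 (mult+4 q)) z<s (sym (shift 2 (7 + x) 1)) r≤n (spare 2 budget)

  evade-chased-4 : ∀ {j c c′ x} → Mult4 x → 1 ≤ c → 4 + (4 + x) + c ≤ n → 4 + 3 + suc j + c ≤ n →
                   Move c c′ → InV n c′ → Escape j c′ (4 + (4 + x) + c)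
  evade-chased-4 {j} {c} {x = x} q 1≤c r≤n budget mv c′∈V with mv | c′∈V
  ... | stay _   | _ = escape-ahead-4 (mult+4 q) 1≤c refl r≤n (m+n≤o⇒n≤o 4 budget)
  ... | up1 _    | _ = escape-ahead-3′ (mult+4 q) z<s (shift 1 (7 + x) c) r≤n (spare 2 budget)
  ... | up3 _    | _ = escape-ahead-1 (mult+4 q) z<s (shift 3 (5 + x) c) r≤n (spare 3 budget)
  ... | up4 _    | _ = escape-ahead-4 q z<s (shift 4 (4 + x) c) r≤n (shift-≤ 4 (4 + j) c budget)
  ... | down1 c′ | (1≤c′ , _) =
    escape-ahead-1 (mult+4 (mult+4 q)) 1≤c′ (sym (shift 1 (8 + x) c′)) r≤n (spare 3 budget)
  ... | down3 c′ | (1≤c′ , _) =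
    escape-ahead-3′ (mult+4 (mult+4 q)) 1≤c′ (sym (shift 3 (8 + x) c′)) r≤n (spare 2 budget)
  ... | down4 c′ | (1≤c′ , _) =
    escape-ahead-4 (mult+4 (mult+4 q)) 1≤c′ (sym (shift 4 (8 + x) c′)) r≤n
                   (m+n≤o⇒n≤o 8 (unshift-≤ 4 (8 + j) c′ budget))
  ... | up13     | _ =
    escape-ahead-2 (mult+4 q) z<s (shift 2 (6 + x) 1) r≤n (spare 3 budget)
  ... | down31   | _ =
    escape-ahead-2 (mult+4 (mult+4 q)) z<s (sym (shift 2 (8 + x) 1)) r≤n (spare 3 budget)

  evade-ahead-by-2 : ∀ {j c c′ x} → Mult4 x → 3 ≤ c → 2 + x + c ≤ n → 5 + j ≤ n →
                     Move c c′ → InV n c′ → Escape j c′ (2 + x + c)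
  evade-ahead-by-2 {c = c} {x = x} q 3≤c r≤n budget mv c′∈V with mv | c′∈V | q
  ... | stay _   | _          | _ = escape-ahead-2 q (≤-trans z<s 3≤c) refl r≤n budget
  ... | up1 _    | _          | _ = escape-ahead-1 q z<s (shift 1 (1 + x) c) r≤n budget
  ... | up3 _    | (_ , c′≤n) | mult0 = escape-behind-1 2≤2+ c′≤n budget
  ... | up3 _    | _          | mult+4 {x′} q′ = escape-ahead-3 q′ (s≤s z<s) (shift 3 (3 + x′) c) r≤n budget
  ... | up4 _    | (_ , c′≤n) | mult0 = escape-to-behind-2 (stay _) (behind-≢ 1) 2≤2+ r≤n 2≤2+ c′≤n budget
  ... | up4 _    | _          | mult+4 {x′} q′ = escape-ahead-2 q′ z<s (shift 4 (2 + x′) c) r≤n budget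
  ... | down1 c′ | _          | _ = escape-ahead-3 q (s≤s⁻¹ 3≤c) (sym (shift 1 (2 + x) c′)) r≤n budget
  ... | down3 c′ | (1≤c′ , _) | _ = escape-ahead-1 (mult+4 q) 1≤c′ (sym (shift 3 (2 + x) c′)) r≤n budget
  ... | down4 c′ | (1≤c′ , _) | _ = escape-ahead-2 (mult+4 q) 1≤c′ (sym (shift 4 (2 + x) c′)) r≤n budget
  ... | down31   | _          | _ = escape-ahead-4 q z<s (sym (shift 2 (2 + x) 1)) r≤n (budget-at-1 _ budget)
  ... | up13     | _          | _ = ⊥-elim (3≰1 3≤c)
    where
    3≰1 : ¬ 3 ≤ 1
    3≰1 (s≤s ())

  evade-ahead-by-2-of-2 : ∀ {j c′ x} → Mult4 x → 2 + x + 2 ≤ n → 6 + j ≤ n →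
                          Move 2 c′ → InV n c′ → Escape j c′ (2 + x + 2)
  evade-ahead-by-2-of-2 {j} {x = x} q r≤n budget mv c′∈V with mv | c′∈V | q
  ... | stay _  | _          | _ = escape-ahead-2 q z<s refl r≤n (m+n≤o⇒n≤o 1 budget)
  ... | up1 _   | _          | _ = escape-ahead-1 q z<s (shift 1 (1 + x) 2) r≤n (m+n≤o⇒n≤o 1 budget)
  ... | up3 _   | (_ , c′≤n) | mult0 = escape-behind-1 2≤2+ c′≤n (m+n≤o⇒n≤o 1 budget)
  ... | up3 _   | _          | mult+4 {x′} q′ =
    escape-ahead-3 q′ (s≤s z<s) (shift 3 (3 + x′) 2) r≤n (m+n≤o⇒n≤o 1 budget)
  ... | up4 _   | (_ , c′≤n) | mult0 =
    escape-to-behind-2 (stay _) (behind-≢ 1) 2≤2+ r≤n 2≤2+ c′≤n (m+n≤o⇒n≤o 1 budget)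
  ... | up4 _   | _          | mult+4 {x′} q′ =
    escape-ahead-2 q′ z<s (shift 4 (2 + x′) 2) r≤n (m+n≤o⇒n≤o 1 budget)
  ... | down1 _ | _          | _ = escape-ahead-3′ q z<s (sym (shift 1 (2 + x) 1)) r≤n budget

  evade-behind-by-2 : ∀ {j r c′} → 2 ≤ r → r ≤ n → 5 + j ≤ n → Move (2 + r) c′ → InV n c′ → Escape j c′ r
  evade-behind-by-2 {r = r} 2≤r r≤n budget mv c′∈V with mv | c′∈V
  ... | stay _   | (_ , c′≤n) = escape-to-behind-2 (stay _) (behind-≢ 1) 2≤r r≤n 2≤r c′≤n budget
  ... | up1 _    | (_ , c′≤n) = escape-to-behind-2 (up1 _) (behind-≢ 2) 2≤r r≤n (m≤n⇒m≤o+n 1 2≤r) c′≤n budget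
  ... | up3 _    | (_ , c′≤n) = escape-to-behind-2 (up3 _) (behind-≢ 4) 2≤r r≤n (m≤n⇒m≤o+n 3 2≤r) c′≤n budget
  ... | up4 _    | (_ , c′≤n) = escape-to-behind-2 (up4 _) (behind-≢ 5) 2≤r r≤n (m≤n⇒m≤o+n 4 2≤r) c′≤n budget
  ... | down1 _  | (_ , c′≤n) = escape-behind-1 2≤r c′≤n budget
  ... | down3 c′ | (1≤c′ , _) = escape-ahead-1 mult0 1≤c′ refl r≤n budget
  ... | down4 c′ | (1≤c′ , _) = escape-ahead-2 mult0 1≤c′ refl r≤n budget
  ... | down31   | _          = ⊥-elim (1+n≰n 2≤r)

  evade : ∀ {j c c′ r} → Safe (suc j) c r → Move c c′ → InV n c′ → Escape j c′ r
  evade (chased adv1 q 1≤c refl r≤n budget) = evade-chased-1 q 1≤c r≤n budget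
  evade (chased adv2 q _ refl r≤n budget)   = evade-chased-2 q r≤n budget
  evade (chased adv3 q 1≤c refl r≤n budget) = evade-chased-3 q 1≤c r≤n budget
  evade (chased adv4 q 1≤c refl r≤n budget) = evade-chased-4 q 1≤c r≤n budget
  evade (ahead-by-2 q 3≤c refl r≤n budget)  = evade-ahead-by-2 q 3≤c r≤n budget
  evade (ahead-by-2-of-2 q refl r≤n budget) = evade-ahead-by-2-of-2 q r≤n budget
  evade (behind-by-2 2≤r r≤n budget)        = evade-behind-by-2 2≤r r≤n budget

  apart : ∀ {j c r} → Safe j c r → c ≢ r
  apart (chased {x = x} adv1 _ _ refl _ _)    = ahead-≢ 0 (4 + x)
  apart (chased {x = x} adv2 _ _ refl _ _)    = ahead-≢ 1 (4 + x)
  apart (chased {x = x} adv3 _ _ refl _ _)    = ahead-≢ 2 (4 + x)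
  apart (chased {x = x} adv4 _ _ refl _ _)    = ahead-≢ 3 (4 + x)
  apart (ahead-by-2 {x = x} _ _ refl _ _)     = ahead-≢ 1 x
  apart (ahead-by-2-of-2 {x = x} _ refl _ _)  = ahead-≢ 1 x
  apart (behind-by-2 _ _ _)                   = behind-≢ 1
  apart (last-round c≢r)                      = c≢r

  survives : ∀ j {c r} → Safe j c r → ¬ CopWins n j c r
  survives zero    safe c≡r        = apart safe c≡r
  survives (suc j) safe (inj₁ c≡r) = apart safe c≡r
  survives (suc j) safe (inj₂ (c′ , a@(_ , c′∈V , _) , next)) with evade safe (adj⇒move a) c′∈V | next
  ... | c′≢r , _  , _  , _     | inj₁ c′≡r = c′≢r c′≡r
  ... | _    , r′ , a′ , safe′ | inj₂ win  = survives j safe′ (win r′ a′)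

  full-budget : 4 + (n ∸ 4) ≤ n
  full-budget = ≤-reflexive (m+[n∸m]≡n (m+n≤o⇒n≤o 3 7≤n))

  start : ∀ {v} → 3 ≤ v → v ≤ n → Σ ℕ λ r → InV n r × Safe (n ∸ 4) v r
  start {v} 3≤v@(s≤s (s≤s (s≤s _))) v≤n with 2 + v ≤? n
  ... | yes 2+v≤n = 2 + v , (z<s , 2+v≤n) , ahead-by-2 mult0 3≤v refl 2+v≤n full-budget
  start {3} _ _ | no 5≰n = ⊥-elim (5≰n (m+n≤o⇒n≤o 2 7≤n))
  start {suc (suc (suc (suc r)))} _ v≤n | no _ =
    2 + r , (z<s , m+n≤o⇒n≤o 2 v≤n) , behind-by-2 2≤2+ (m+n≤o⇒n≤o 2 v≤n) full-budget

cop-wins : ∀ n → 7 ≤ n → ∀ v → v ≡ 1 ⊎ v ≡ 2 → CanCaptureFrom n (n ∸ 4) v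
cop-wins _ (s≤s (s≤s (s≤s (s≤s (s≤s (s≤s (s≤s {n = m} z≤n))))))) _ (inj₁ refl) = capture-from-1 m
cop-wins _ (s≤s (s≤s (s≤s (s≤s (s≤s (s≤s (s≤s {n = m} z≤n))))))) _ (inj₂ refl) = capture-from-2 m

robber-wins : ∀ n → 7 ≤ n → ∀ v → 3 ≤ v → v ≤ n → ¬ CanCaptureFrom n (n ∸ 4) v
robber-wins n 7≤n v 3≤v v≤n capture with Robber.start n 7≤n 3≤v v≤n
... | r , r∈V , safe = Robber.survives n 7≤n (n ∸ 4) safe (capture r r∈V)

lemma3p4 : ∀ n → 7 ≤ n → ∀ v → InV n v →
    (CanCaptureFrom n (n ∸ 4) v ⇔ (v ≡ 1 ⊎ v ≡ 2))
lemma3p4 n 7≤n v (1≤v , v≤n) = mk⇔ (start-is-1-or-2 v 1≤v v≤n) (cop-wins n 7≤n v)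
  where
  start-is-1-or-2 : ∀ v → 1 ≤ v → v ≤ n → CanCaptureFrom n (n ∸ 4) v → v ≡ 1 ⊎ v ≡ 2
  start-is-1-or-2 1 _ _ _ = inj₁ refl
  start-is-1-or-2 2 _ _ _ = inj₂ refl
  start-is-1-or-2 (suc (suc (suc v))) _ v≤n capture =
    ⊥-elim (robber-wins n 7≤n _ (s≤s (s≤s (s≤s z≤n))) v≤n capture)
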